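{- If $\sigma\ge3$ and $k\ge4$, then there exist strings over an alphabet of size $\sigma$ which are $k$-covering but not $(k-1)$-covering.
   Context: Let $\Sigma=\{a_1<\dots<a_\sigma\}$. For a string $u$, $\mathbf{pv}(u)\in\mathbb{N}^\sigma$ has $i$-th entry the number of occurrences of $a_i$ in $u$; the order of a Parikh vector is the sum of its entries. A string $w$ over $\Sigma$ is $k$-covering if for every Parikh vector $p\in\mathbb{N}^\sigma$ of order $k$ there is a substring $u$ of $w$ with $\mathbf{pv}(u)=p$. -}

module Defs where

open import Data.Nat using (ℕ; zero; suc; _+_)
open import Data.Fin using (Fin; _≟_)
open import Data.List using (List; _++_; []; _∷_)
open import Data.Vec using (Vec; tabulate; sum)
open import Data.Product using (∃; ∃-syntax; _×_)
open import Relation.Binary.PropositionalEquality using (_≡_)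
open import Relation.Nullary using (yes; no; ¬_)

count : ∀ {σ} → Fin σ → List (Fin σ) → ℕ
count a [] = 0
count a (b ∷ u) with a ≟ b
... | yes _ = suc (count a u)
... | no _ = count a u

pv : ∀ {σ} → List (Fin σ) → Vec ℕ σ
pv u = tabulate (λ a → count a u)

order : ∀ {σ} → Vec ℕ σ → ℕ
order p = sum p

Substring : ∀ {σ} → List (Fin σ) → List (Fin σ) → Set
Substring {σ} u w = ∃[ x ] ∃[ y ] (w ≡ x ++ (u ++ y))

Covering : ∀ {σ} → ℕ → List (Fin σ) → Set
Covering {σ} k w =
  (p : Vec ℕ σ) → order p ≡ k → ∃[ u ] (Substring u w × pv u ≡ p)

-- Write 𝕒, 𝕓, 𝕔 for the three smallest letters and k = m + 4. The target vector
-- (m + 1, 1, 1, 0, …, 0) has order k − 1. The witness concatenates, over all Parikh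
-- vectors p of order k, frames 𝕓𝕓 B 𝕔𝕔 in which B lists the letters of p as runs, all
-- further letters forming one block X. With at least two 𝕔's, B = 𝕓* 𝕔* X 𝕒*; with at
-- least two 𝕓's, B = 𝕒* X 𝕓* 𝕔*; in both cases a 𝕓 meets a 𝕔 only with no 𝕒 around. Otherwise
-- B = 𝕓* 𝕒* X 𝕔*, whose only candidate factor 𝕓 𝕒^p₀ 𝕔 needs X empty and p₀ = m + 1, which
-- contradicts order k. Across frames, a factor with one 𝕓 and one 𝕔 is 𝕔𝕓, which has no 𝕒.
-- Absence of the target is checked by running, from every suffix, an automaton counting 𝕒, 𝕓, 𝕔.

module Submission where

open import Defs
open import Data.Nat using (ℕ; zero; suc; _+_; _≤_; _∸_; z≤n; s≤s; _≤?_)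
open import Data.Nat.Properties using (+-suc; +-comm; +-cancelˡ-≡; +-mono-≤; ≤-reflexive; ≤-pred; ≰⇒>)
open import Data.Fin using (Fin; zero; suc; _≟_)
open import Data.Fin.Properties using (suc-injective)
open import Data.List using (List; []; _∷_; _++_; map; replicate; foldr; length)
open import Data.List.Properties using (++-assoc; length-++; length-map; length-replicate; map-++; map-replicate; map-∘)
open import Data.List.Membership.Propositional using (_∈_)
open import Data.List.Membership.Propositional.Properties using (∈-map⁺; ∈-++⁺ˡ; ∈-++⁺ʳ)
open import Data.List.Relation.Unary.Any using (here; there)
open import Data.List.Relation.Unary.All as All using (All; []; _∷_)
open import Data.List.Relation.Unary.All.Properties using (map⁺; ++⁺)
import Data.List.Relation.Binary.Permutation.Propositional as ↭
open ↭ using (_↭_; ↭-reflexive; ↭-trans)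
open import Data.List.Relation.Binary.Permutation.Propositional.Properties using (++⁺ˡ; ++-comm; shifts)
open import Data.Vec using (Vec; lookup; sum) renaming ([] to []ᵥ; _∷_ to _∷ᵥ_; replicate to replicateᵥ)
open import Data.Vec.Properties using (lookup∘tabulate; tabulate∘lookup; tabulate-cong; lookup-replicate)
open import Data.Product using (∃-syntax; _×_; _,_; proj₁)
open import Data.Unit using (⊤; tt)
open import Data.Empty using (⊥; ⊥-elim)
open import Function using (_∘_)
open import Relation.Binary.PropositionalEquality using (_≡_; _≢_; refl; sym; trans; cong; cong₂; subst; module ≡-Reasoning)
open import Relation.Nullary using (¬_; Dec; yes; no)

module _ {σ : ℕ} where

  count-≡ : ∀ {a b : Fin σ} l → a ≡ b → count a (b ∷ l) ≡ suc (count a l)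
  count-≡ {a} {b} l a≡b with a ≟ b
  ... | yes _ = refl
  ... | no a≢b = ⊥-elim (a≢b a≡b)

  count-≢ : ∀ {a b : Fin σ} l → a ≢ b → count a (b ∷ l) ≡ count a l
  count-≢ {a} {b} l a≢b with a ≟ b
  ... | yes a≡b = ⊥-elim (a≢b a≡b)
  ... | no _ = refl

  count-++ : ∀ (a : Fin σ) xs ys → count a (xs ++ ys) ≡ count a xs + count a ys
  count-++ a [] ys = refl
  count-++ a (b ∷ xs) ys with a ≟ b
  ... | yes _ = cong suc (count-++ a xs ys)
  ... | no _ = count-++ a xs ys

  count-replicate-≡ : ∀ (a : Fin σ) k → count a (replicate k a) ≡ k
  count-replicate-≡ a zero = refl
  count-replicate-≡ a (suc k) = trans (count-≡ (replicate k a) refl) (cong suc (count-replicate-≡ a k))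

  count-replicate-≢ : ∀ {a b : Fin σ} k → a ≢ b → count a (replicate k b) ≡ 0
  count-replicate-≢ zero a≢b = refl
  count-replicate-≢ (suc k) a≢b = trans (count-≢ _ a≢b) (count-replicate-≢ k a≢b)

  count-++-comm : ∀ (a : Fin σ) xs ys → count a (xs ++ ys) ≡ count a (ys ++ xs)
  count-++-comm a xs ys = begin
    count a (xs ++ ys)          ≡⟨ count-++ a xs ys ⟩
    count a xs + count a ys     ≡⟨ +-comm (count a xs) _ ⟩
    count a ys + count a xs     ≡⟨ sym (count-++ a ys xs) ⟩
    count a (ys ++ xs)          ∎
    where open ≡-Reasoning

  count-↭ : ∀ (a : Fin σ) {u v} → u ↭ v → count a u ≡ count a v
  count-↭ a ↭.refl = refl
  count-↭ a (↭.prep {xs} {ys} x p) = begin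
    count a ((x ∷ []) ++ xs)           ≡⟨ count-++ a (x ∷ []) xs ⟩
    count a (x ∷ []) + count a xs      ≡⟨ cong (count a (x ∷ []) +_) (count-↭ a p) ⟩
    count a (x ∷ []) + count a ys      ≡⟨ sym (count-++ a (x ∷ []) ys) ⟩
    count a ((x ∷ []) ++ ys)           ∎
    where open ≡-Reasoning
  count-↭ a (↭.swap {xs} {ys} x y p) = begin
    count a ((x ∷ y ∷ []) ++ xs)       ≡⟨ count-++ a (x ∷ y ∷ []) xs ⟩
    count a (x ∷ y ∷ []) + count a xs  ≡⟨ cong₂ _+_ (count-++-comm a (x ∷ []) (y ∷ [])) (count-↭ a p) ⟩
    count a (y ∷ x ∷ []) + count a ys  ≡⟨ sym (count-++ a (y ∷ x ∷ []) ys) ⟩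
    count a ((y ∷ x ∷ []) ++ ys)       ∎
    where open ≡-Reasoning
  count-↭ a (↭.trans p q) = trans (count-↭ a p) (count-↭ a q)

  pv-↭ : ∀ {u v : List (Fin σ)} → u ↭ v → pv u ≡ pv v
  pv-↭ p = tabulate-cong (λ a → count-↭ a p)

  count-pv : ∀ {u : List (Fin σ)} {v} a → pv u ≡ v → count a u ≡ lookup v a
  count-pv {u} a pu≡v = trans (sym (lookup∘tabulate (λ b → count b u) a)) (cong (λ w → lookup w a) pu≡v)

count-map-suc : ∀ {σ} (a : Fin σ) l → count (suc a) (map suc l) ≡ count a l
count-map-suc a [] = refl
count-map-suc a (b ∷ l) = by-cases (a ≟ b)
  where
  by-cases : Dec (a ≡ b) → count (suc a) (suc b ∷ map suc l) ≡ count a (b ∷ l)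
  by-cases (yes refl) = trans (count-≡ (map suc l) refl) (trans (cong suc (count-map-suc a l)) (sym (count-≡ l refl)))
  by-cases (no a≢b) = trans (count-≢ (map suc l) (a≢b ∘ suc-injective)) (trans (count-map-suc a l) (sym (count-≢ l a≢b)))

count-zero-map-suc : ∀ {σ} (l : List (Fin σ)) → count zero (map suc l) ≡ 0
count-zero-map-suc [] = refl
count-zero-map-suc (b ∷ l) = count-zero-map-suc l

map-suc-replicate-++ : ∀ {σ} j (x : Fin σ) ys → map suc (replicate j x ++ ys) ≡ replicate j (suc x) ++ map suc ys
map-suc-replicate-++ j x ys = trans (map-++ suc (replicate j x) ys) (cong (_++ map suc ys) (map-replicate suc j x))

runs : ∀ {σ} → Vec ℕ σ → List (Fin σ)
runs []ᵥ = []
runs (r ∷ᵥ rs) = replicate r zero ++ map suc (runs rs)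

count-runs : ∀ {σ} (v : Vec ℕ σ) a → count a (runs v) ≡ lookup v a
count-runs (r ∷ᵥ rs) zero = begin
  count zero (replicate r zero ++ map suc (runs rs))            ≡⟨ count-++ zero (replicate r zero) _ ⟩
  count zero (replicate r zero) + count zero (map suc (runs rs)) ≡⟨ cong₂ _+_ (count-replicate-≡ zero r) (count-zero-map-suc (runs rs)) ⟩
  r + 0                                                          ≡⟨ +-comm r 0 ⟩
  r                                                              ∎
  where open ≡-Reasoning
count-runs (r ∷ᵥ rs) (suc a) = begin
  count (suc a) (replicate r zero ++ map suc (runs rs))               ≡⟨ count-++ (suc a) (replicate r zero) _ ⟩
  count (suc a) (replicate r zero) + count (suc a) (map suc (runs rs)) ≡⟨ cong₂ _+_ (count-replicate-≢ r (λ ())) (count-map-suc a (runs rs)) ⟩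
  count a (runs rs)                                                    ≡⟨ count-runs rs a ⟩
  lookup rs a                                                          ∎
  where open ≡-Reasoning

pv-runs : ∀ {σ} (v : Vec ℕ σ) → pv (runs v) ≡ v
pv-runs v = trans (tabulate-cong (count-runs v)) (tabulate∘lookup v)

length-runs : ∀ {σ} (v : Vec ℕ σ) → length (runs v) ≡ sum v
length-runs []ᵥ = refl
length-runs (r ∷ᵥ rs) = begin
  length (replicate r zero ++ map suc (runs rs))          ≡⟨ length-++ (replicate r zero) ⟩
  length (replicate r zero) + length (map suc (runs rs))  ≡⟨ cong₂ _+_ (length-replicate r) (length-map suc (runs rs)) ⟩
  r + length (runs rs)                                    ≡⟨ cong (r +_) (length-runs rs) ⟩
  r + sum rs                                              ∎
  where open ≡-Reasoning

sum-replicate-0 : ∀ j → sum (replicateᵥ j 0) ≡ 0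
sum-replicate-0 zero = refl
sum-replicate-0 (suc j) = sum-replicate-0 j

bumpHead : ∀ {n} → Vec ℕ (suc n) → Vec ℕ (suc n)
bumpHead (a ∷ᵥ v) = suc a ∷ᵥ v

compositions : (n k : ℕ) → List (Vec ℕ n)
compositions zero zero = []ᵥ ∷ []
compositions zero (suc k) = []
compositions (suc n) zero = map (0 ∷ᵥ_) (compositions n zero)
compositions (suc n) (suc k) = map (0 ∷ᵥ_) (compositions n (suc k)) ++ map bumpHead (compositions (suc n) k)

∷-∈-compositions : ∀ {n} a {k} {v : Vec ℕ n} → v ∈ compositions n k → (a ∷ᵥ v) ∈ compositions (suc n) (a + k)
∷-∈-compositions zero {zero} v∈ = ∈-map⁺ (0 ∷ᵥ_) v∈
∷-∈-compositions zero {suc k} v∈ = ∈-++⁺ˡ (∈-map⁺ (0 ∷ᵥ_) v∈)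
∷-∈-compositions {n} (suc a) {k} v∈ =
  ∈-++⁺ʳ (map (0 ∷ᵥ_) (compositions n (suc (a + k)))) (∈-map⁺ bumpHead (∷-∈-compositions a v∈))

∈-compositions : ∀ {n} (v : Vec ℕ n) → v ∈ compositions n (sum v)
∈-compositions []ᵥ = here refl
∈-compositions (a ∷ᵥ v) = ∷-∈-compositions a (∈-compositions v)

sum-bumpHead : ∀ {n k} (v : Vec ℕ (suc n)) → sum v ≡ k → sum (bumpHead v) ≡ suc k
sum-bumpHead (a ∷ᵥ v) = cong suc

compositions-sum : ∀ n k → All (λ v → sum v ≡ k) (compositions n k)
compositions-sum zero zero = refl ∷ []
compositions-sum zero (suc k) = []
compositions-sum (suc n) zero = map⁺ (compositions-sum n zero)
compositions-sum (suc n) (suc k) =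
  ++⁺ (map⁺ (compositions-sum n (suc k))) (map⁺ (All.map (λ {v} → sum-bumpHead v) (compositions-sum (suc n) k)))

++-assoc₄ : ∀ {A : Set} (P Q R S t : List A) → (P ++ Q ++ R ++ S) ++ t ≡ P ++ Q ++ R ++ S ++ t
++-assoc₄ P Q R S t = begin
  (P ++ Q ++ R ++ S) ++ t   ≡⟨ ++-assoc P _ t ⟩
  P ++ (Q ++ R ++ S) ++ t   ≡⟨ cong (P ++_) (++-assoc Q _ t) ⟩
  P ++ Q ++ (R ++ S) ++ t   ≡⟨ cong (λ x → P ++ Q ++ x) (++-assoc R S t) ⟩
  P ++ Q ++ R ++ S ++ t     ∎
  where open ≡-Reasoning

Substring-++ʳ : ∀ {σ} {u s : List (Fin σ)} x → Substring u s → Substring u (x ++ s)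
Substring-++ʳ {u = u} x (y , z , refl) = x ++ y , z , sym (++-assoc x y (u ++ z))

pattern 𝕒 = zero
pattern 𝕓 = suc zero
pattern 𝕔 = suc (suc zero)
pattern other j = suc (suc (suc j))

module Construction (n m : ℕ) where

  Letter : Set
  Letter = Fin (3 + n)

  k : ℕ
  k = 4 + m

  others : List (Fin n) → List Letter
  others = map (λ j → other j)

  NotTarget : ℕ → ℕ → ℕ → Set
  NotTarget a b c = (a , b , c) ≢ (suc m , 1 , 1)

  -- Safe a b c s: after a prefix with a 𝕒's, b 𝕓's and c 𝕔's, no prefix of s brings these
  -- counts to those of the target; any other letter ends every candidate factor.
  data Safe : ℕ → ℕ → ℕ → List Letter → Set where
    end : ∀ {a b c} → NotTarget a b c → Safe a b c []
    read-𝕒 : ∀ {a b c s} → NotTarget a b c → Safe (suc a) b c s → Safe a b c (𝕒 ∷ s)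
    read-𝕓 : ∀ {a b c s} → NotTarget a b c → Safe a (suc b) c s → Safe a b c (𝕓 ∷ s)
    read-𝕔 : ∀ {a b c s} → NotTarget a b c → Safe a b (suc c) s → Safe a b c (𝕔 ∷ s)
    read-other : ∀ {a b c j s} → NotTarget a b c → Safe a b c (other j ∷ s)

  safe-𝕓≥2 : ∀ {a b c} s → Safe a (2 + b) c s
  safe-𝕓≥2 [] = end (λ ())
  safe-𝕓≥2 (𝕒 ∷ s) = read-𝕒 (λ ()) (safe-𝕓≥2 s)
  safe-𝕓≥2 (𝕓 ∷ s) = read-𝕓 (λ ()) (safe-𝕓≥2 s)
  safe-𝕓≥2 (𝕔 ∷ s) = read-𝕔 (λ ()) (safe-𝕓≥2 s)
  safe-𝕓≥2 (other _ ∷ s) = read-other (λ ())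

  safe-𝕔≥2 : ∀ {a b c} s → Safe a b (2 + c) s
  safe-𝕔≥2 [] = end (λ ())
  safe-𝕔≥2 (𝕒 ∷ s) = read-𝕒 (λ ()) (safe-𝕔≥2 s)
  safe-𝕔≥2 (𝕓 ∷ s) = read-𝕓 (λ ()) (safe-𝕔≥2 s)
  safe-𝕔≥2 (𝕔 ∷ s) = read-𝕔 (λ ()) (safe-𝕔≥2 s)
  safe-𝕔≥2 (other _ ∷ s) = read-other (λ ())

  safe-𝕓 : ∀ {a c s} → NotTarget a 1 c → Safe a 1 c (𝕓 ∷ s)
  safe-𝕓 nt = read-𝕓 nt (safe-𝕓≥2 _)

  safe-𝕔 : ∀ {a b s} → NotTarget a b 1 → Safe a b 1 (𝕔 ∷ s)
  safe-𝕔 nt = read-𝕔 nt (safe-𝕔≥2 _)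

  safe-𝕓𝕓 : ∀ {a c s} → NotTarget a 1 c → Safe a 0 c (𝕓 ∷ 𝕓 ∷ s)
  safe-𝕓𝕓 nt = read-𝕓 (λ ()) (safe-𝕓 nt)

  safe-𝕔𝕔 : ∀ {a b s} → NotTarget a b 1 → Safe a b 0 (𝕔 ∷ 𝕔 ∷ s)
  safe-𝕔𝕔 nt = read-𝕔 (λ ()) (safe-𝕔 nt)

  safe-𝕓* : ∀ {a c} t → NotTarget a 1 c → Safe a 1 c t → ∀ j → Safe a 1 c (replicate j 𝕓 ++ t)
  safe-𝕓* t nt safe zero = safe
  safe-𝕓* t nt safe (suc j) = safe-𝕓 nt

  safe-𝕔* : ∀ {a b} t → NotTarget a b 1 → Safe a b 1 t → ∀ j → Safe a b 1 (replicate j 𝕔 ++ t)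
  safe-𝕔* t nt safe zero = safe
  safe-𝕔* t nt safe (suc j) = safe-𝕔 nt

  safe-𝕔*𝕔𝕔 : ∀ {a b} → NotTarget a b 1 → ∀ j s → Safe a b 0 (replicate j 𝕔 ++ 𝕔 ∷ 𝕔 ∷ s)
  safe-𝕔*𝕔𝕔 nt zero s = safe-𝕔𝕔 nt
  safe-𝕔*𝕔𝕔 nt (suc j) s = read-𝕔 (λ ()) (safe-𝕔* (𝕔 ∷ 𝕔 ∷ s) nt (safe-𝕔 nt) j)

  safe-𝕒* : ∀ {b c} → (∀ a → NotTarget a b c) → ∀ j {a} t → Safe (a + j) b c t → Safe a b c (replicate j 𝕒 ++ t)
  safe-𝕒* nt zero {a} t safe = subst (λ x → Safe x _ _ t) (+-comm a 0) safe
  safe-𝕒* {b} {c} nt (suc j) {a} t safe =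
    read-𝕒 (nt a) (safe-𝕒* nt j t (subst (λ x → Safe x b c t) (+-suc a j) safe))

  safe-others : ∀ {a b c} L s → NotTarget a b c → (L ≡ [] → Safe a b c s) → Safe a b c (others L ++ s)
  safe-others [] s nt safe = safe refl
  safe-others (_ ∷ _) s nt safe = read-other nt

  SafeStarts : List Letter → List Letter → Set
  SafeStarts [] t = ⊤
  SafeStarts (x ∷ xs) t = Safe 0 0 0 (x ∷ xs ++ t) × SafeStarts xs t

  SafeSuffixes : List Letter → Set
  SafeSuffixes [] = ⊤
  SafeSuffixes (x ∷ s) = Safe 0 0 0 (x ∷ s) × SafeSuffixes s

  safeSuffixes-++ : ∀ xs ys → SafeStarts xs ys → SafeSuffixes ys → SafeSuffixes (xs ++ ys)
  safeSuffixes-++ [] ys _ safe = safe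
  safeSuffixes-++ (x ∷ xs) ys (head , starts) safe = head , safeSuffixes-++ xs ys starts safe

  safeSuffixes⇒safe : ∀ xs ys → SafeSuffixes (xs ++ ys) → Safe 0 0 0 ys
  safeSuffixes⇒safe [] [] _ = end (λ ())
  safeSuffixes⇒safe [] (y ∷ ys) (head , _) = head
  safeSuffixes⇒safe (x ∷ xs) ys (_ , rest) = safeSuffixes⇒safe xs ys rest

  safeStarts-𝕒* : ∀ {t} → (∀ a → Safe a 0 0 t) → ∀ j → SafeStarts (replicate j 𝕒) t
  safeStarts-𝕒* safe zero = tt
  safeStarts-𝕒* {t} safe (suc j) = safe-𝕒* (λ _ ()) (suc j) t (safe (suc j)) , safeStarts-𝕒* safe j

  safeStarts-𝕓* : ∀ {t} → Safe 0 1 0 t → ∀ j → SafeStarts (replicate j 𝕓) t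
  safeStarts-𝕓* safe zero = tt
  safeStarts-𝕓* {t} safe (suc j) = read-𝕓 (λ ()) (safe-𝕓* t (λ ()) safe j) , safeStarts-𝕓* safe j

  safeStarts-𝕔* : ∀ {t} → Safe 0 0 1 t → ∀ j → SafeStarts (replicate j 𝕔) t
  safeStarts-𝕔* safe zero = tt
  safeStarts-𝕔* {t} safe (suc j) = read-𝕔 (λ ()) (safe-𝕔* t (λ ()) safe j) , safeStarts-𝕔* safe j

  safeStarts-others : ∀ L t → SafeStarts (others L) t
  safeStarts-others [] t = tt
  safeStarts-others (_ ∷ L) t = read-other (λ ()) , safeStarts-others L t

  frame : List Letter → List Letter → List Letter
  frame B s = 𝕓 ∷ 𝕓 ∷ B ++ 𝕔 ∷ 𝕔 ∷ s

  -- Safe 0 0 1 s speaks about the suffix starting at the last 𝕔 of the frame; it holds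
  -- because the next frame starts with 𝕓𝕓.
  SafeBlock : List Letter → Set
  SafeBlock B = ∀ s → Safe 0 0 1 s → SafeSuffixes s → SafeSuffixes (frame B s)

  safeBlock₄ : ∀ P Q R S →
    (∀ s → let t = 𝕔 ∷ 𝕔 ∷ s in
      Safe 0 1 0 (P ++ Q ++ R ++ S ++ t) ×
      SafeStarts P (Q ++ R ++ S ++ t) × SafeStarts Q (R ++ S ++ t) × SafeStarts R (S ++ t) × SafeStarts S t) →
    SafeBlock (P ++ Q ++ R ++ S)
  safeBlock₄ P Q R S pieces s boundary safe-s
    with entry , sP , sQ , sR , sS ← pieces s
    rewrite ++-assoc₄ P Q R S (𝕔 ∷ 𝕔 ∷ s) =
      safe-𝕓𝕓 (λ ()) , read-𝕓 (λ ()) entry ,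
      safeSuffixes-++ P _ sP (safeSuffixes-++ Q _ sQ (safeSuffixes-++ R _ sR (safeSuffixes-++ S _ sS
        (safeSuffixes-++ (𝕔 ∷ 𝕔 ∷ []) s (safeStarts-𝕔* boundary 2) safe-s))))

  data Shape (p1 p2 : ℕ) : Set where
    many𝕔 : 2 ≤ p2 → Shape p1 p2
    many𝕓 : 2 ≤ p1 → Shape p1 p2
    sparse : p1 ≤ 1 → p2 ≤ 1 → Shape p1 p2

  shape : ∀ p1 p2 → Shape p1 p2
  shape p1 p2 with 2 ≤? p2 | 2 ≤? p1
  ... | yes 2≤p2 | _ = many𝕔 2≤p2
  ... | no _ | yes 2≤p1 = many𝕓 2≤p1
  ... | no 2≰p2 | no 2≰p1 = sparse (≤-pred (≰⇒> 2≰p1)) (≤-pred (≰⇒> 2≰p2))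

  arrange : ∀ {p1 p2} → Shape p1 p2 → ℕ → List (Fin n) → List Letter
  arrange {p1} {p2} (many𝕔 _) p0 L = replicate p1 𝕓 ++ replicate p2 𝕔 ++ others L ++ replicate p0 𝕒
  arrange {p1} {p2} (many𝕓 _) p0 L = replicate p0 𝕒 ++ others L ++ replicate p1 𝕓 ++ replicate p2 𝕔
  arrange {p1} {p2} (sparse _ _) p0 L = replicate p1 𝕓 ++ replicate p0 𝕒 ++ others L ++ replicate p2 𝕔

  many𝕔-safe : ∀ {p1 p2} (2≤p2 : 2 ≤ p2) p0 L → SafeBlock (arrange {p1} (many𝕔 2≤p2) p0 L)
  many𝕔-safe {p1} {p2} (s≤s (s≤s _)) p0 L = safeBlock₄ _ _ _ _ λ s →
    safe-𝕓* _ (λ ()) (safe-𝕔𝕔 (λ ())) p1 ,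
    safeStarts-𝕓* (safe-𝕔𝕔 (λ ())) p1 ,
    safeStarts-𝕔* (safe-others L _ (λ ()) (λ _ → safe-𝕒* (λ _ ()) p0 _ (safe-𝕔 (λ ())))) p2 ,
    safeStarts-others L _ ,
    safeStarts-𝕒* (λ _ → safe-𝕔𝕔 (λ ())) p0

  many𝕓-safe : ∀ {p1 p2} (2≤p1 : 2 ≤ p1) p0 L → SafeBlock (arrange {p2 = p2} (many𝕓 2≤p1) p0 L)
  many𝕓-safe {p1} {p2} (s≤s (s≤s _)) p0 L = safeBlock₄ _ _ _ _ λ s →
    safe-𝕒* (λ _ ()) p0 _ (safe-others L _ (λ ()) (λ _ → safe-𝕓 (λ ()))) ,
    safeStarts-𝕒* (λ _ → safe-others L _ (λ ()) (λ _ → safe-𝕓𝕓 (λ ()))) p0 ,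
    safeStarts-others L _ ,
    safeStarts-𝕓* (safe-𝕔*𝕔𝕔 (λ ()) p2 s) p1 ,
    safeStarts-𝕔* (safe-𝕔 (λ ())) p2

  sparse-safe : ∀ {p1 p2} (p1≤1 : p1 ≤ 1) (p2≤1 : p2 ≤ 1) p0 L → (L ≡ [] → p0 ≢ suc m) →
    SafeBlock (arrange (sparse p1≤1 p2≤1) p0 L)
  sparse-safe {p1} {p2} _ _ p0 L miss = safeBlock₄ _ _ _ _ λ s →
    safe-𝕓* _ (λ ()) (after-𝕓 s) p1 ,
    safeStarts-𝕓* (after-𝕓 s) p1 ,
    safeStarts-𝕒* (λ _ → safe-others L _ (λ ()) (λ _ → safe-𝕔*𝕔𝕔 (λ ()) p2 s)) p0 ,
    safeStarts-others L _ ,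
    safeStarts-𝕔* (safe-𝕔 (λ ())) p2
    where
    -- 𝕓 𝕒^p₀ 𝕔 is the only candidate factor here, and miss rules it out
    after-𝕓 : ∀ s → Safe 0 1 0 (replicate p0 𝕒 ++ others L ++ replicate p2 𝕔 ++ 𝕔 ∷ 𝕔 ∷ s)
    after-𝕓 s = safe-𝕒* (λ _ ()) p0 _
      (safe-others L _ (λ ()) (λ L≡[] → safe-𝕔*𝕔𝕔 (λ p0≡ → miss L≡[] (cong proj₁ p0≡)) p2 s))

  letters : ℕ → ℕ → ℕ → List (Fin n) → List Letter
  letters p0 p1 p2 L = replicate p0 𝕒 ++ replicate p1 𝕓 ++ replicate p2 𝕔 ++ others L

  arrange-↭ : ∀ {p1 p2} (sh : Shape p1 p2) p0 L → arrange sh p0 L ↭ letters p0 p1 p2 L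
  arrange-↭ {p1} {p2} (many𝕔 _) p0 L = ↭-trans
    (↭-reflexive (sym (trans (++-assoc (replicate p1 𝕓) _ (replicate p0 𝕒))
                                (cong (replicate p1 𝕓 ++_) (++-assoc (replicate p2 𝕔) (others L) _)))))
    (++-comm (replicate p1 𝕓 ++ replicate p2 𝕔 ++ others L) (replicate p0 𝕒))
  arrange-↭ {p1} {p2} (many𝕓 _) p0 L = ++⁺ˡ (replicate p0 𝕒) (↭-trans
    (++-comm (others L) (replicate p1 𝕓 ++ replicate p2 𝕔))
    (↭-reflexive (++-assoc (replicate p1 𝕓) (replicate p2 𝕔) (others L))))
  arrange-↭ {p1} {p2} (sparse _ _) p0 L = ↭-trans
    (shifts (replicate p1 𝕓) (replicate p0 𝕒))
    (++⁺ˡ (replicate p0 𝕒) (++⁺ˡ (replicate p1 𝕓) (++-comm (others L) (replicate p2 𝕔))))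

  runs-letters : ∀ p0 p1 p2 rest → runs (p0 ∷ᵥ p1 ∷ᵥ p2 ∷ᵥ rest) ≡ letters p0 p1 p2 (runs rest)
  runs-letters p0 p1 p2 rest = cong (replicate p0 𝕒 ++_) (begin
    map suc (replicate p1 zero ++ map suc (replicate p2 zero ++ map suc R))
      ≡⟨ map-suc-replicate-++ p1 zero _ ⟩
    replicate p1 𝕓 ++ map suc (map suc (replicate p2 zero ++ map suc R))
      ≡⟨ cong (λ xs → replicate p1 𝕓 ++ map suc xs) (map-suc-replicate-++ p2 zero _) ⟩
    replicate p1 𝕓 ++ map suc (replicate p2 𝕓 ++ map suc (map suc R))
      ≡⟨ cong (replicate p1 𝕓 ++_) (map-suc-replicate-++ p2 𝕓 _) ⟩
    replicate p1 𝕓 ++ replicate p2 𝕔 ++ map suc (map suc (map suc R))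
      ≡⟨ cong (λ xs → replicate p1 𝕓 ++ replicate p2 𝕔 ++ xs) (sym (trans (map-∘ R) (cong (map suc) (map-∘ R)))) ⟩
    replicate p1 𝕓 ++ replicate p2 𝕔 ++ others R
      ∎)
    where
    R = runs rest
    open ≡-Reasoning

  block : Vec ℕ (3 + n) → List Letter
  block (p0 ∷ᵥ p1 ∷ᵥ p2 ∷ᵥ rest) = arrange (shape p1 p2) p0 (runs rest)

  pv-block : ∀ p → pv (block p) ≡ p
  pv-block p@(p0 ∷ᵥ p1 ∷ᵥ p2 ∷ᵥ rest) = begin
    pv (block p)                       ≡⟨ pv-↭ (arrange-↭ (shape p1 p2) p0 (runs rest)) ⟩
    pv (letters p0 p1 p2 (runs rest))  ≡⟨ cong pv (sym (runs-letters p0 p1 p2 rest)) ⟩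
    pv (runs p)                        ≡⟨ pv-runs p ⟩
    p                                  ∎
    where open ≡-Reasoning

  sparse-miss : ∀ {p0 p1 p2} (rest : Vec ℕ n) → p1 ≤ 1 → p2 ≤ 1 → order (p0 ∷ᵥ p1 ∷ᵥ p2 ∷ᵥ rest) ≡ k →
    runs rest ≡ [] → p0 ≢ suc m
  sparse-miss {p1 = p1} {p2} rest p1≤1 p2≤1 ord runs≡[] refl = 3≰2 (subst (_≤ 2) tail-sum≡3 tail-sum≤2)
    where
    tail-sum≡3 : p1 + (p2 + sum rest) ≡ 3
    tail-sum≡3 = +-cancelˡ-≡ (suc m) _ 3 (trans ord (+-comm 3 (suc m)))
    tail-sum≤2 : p1 + (p2 + sum rest) ≤ 2
    tail-sum≤2 = +-mono-≤ p1≤1 (+-mono-≤ p2≤1 (≤-reflexive (trans (sym (length-runs rest)) (cong length runs≡[]))))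
    3≰2 : ¬ 3 ≤ 2
    3≰2 (s≤s (s≤s ()))

  safeBlock-block : ∀ p → order p ≡ k → SafeBlock (block p)
  safeBlock-block (p0 ∷ᵥ p1 ∷ᵥ p2 ∷ᵥ rest) ord with shape p1 p2
  ... | many𝕔 2≤p2 = many𝕔-safe {p1} 2≤p2 p0 (runs rest)
  ... | many𝕓 2≤p1 = many𝕓-safe {p2 = p2} 2≤p1 p0 (runs rest)
  ... | sparse p1≤1 p2≤1 = sparse-safe p1≤1 p2≤1 p0 (runs rest) (sparse-miss rest p1≤1 p2≤1 ord)

  word : List (Vec ℕ (3 + n)) → List Letter
  word = foldr (frame ∘ block) []

  block-substring : ∀ {p ps} → p ∈ ps → Substring (block p) (word ps)
  block-substring {ps = p ∷ ps} (here refl) = 𝕓 ∷ 𝕓 ∷ [] , 𝕔 ∷ 𝕔 ∷ word ps , refl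
  block-substring {ps = q ∷ ps} (there p∈ps) =
    subst (Substring _) (++-assoc (𝕓 ∷ 𝕓 ∷ block q) _ (word ps))
      (Substring-++ʳ (frame (block q) []) (block-substring p∈ps))

  safe-𝕔-word : ∀ ps → Safe 0 0 1 (word ps)
  safe-𝕔-word [] = end (λ ())
  safe-𝕔-word (_ ∷ _) = safe-𝕓𝕓 (λ ())

  safeSuffixes-word : ∀ ps → All (λ p → order p ≡ k) ps → SafeSuffixes (word ps)
  safeSuffixes-word [] [] = tt
  safeSuffixes-word (p ∷ ps) (ord ∷ ords) =
    safeBlock-block p ord (word ps) (safe-𝕔-word ps) (safeSuffixes-word ps ords)

  safe⇒notTarget : ∀ {a b c t} → Safe a b c t → NotTarget a b c
  safe⇒notTarget (end nt) = nt
  safe⇒notTarget (read-𝕒 nt _) = nt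
  safe⇒notTarget (read-𝕓 nt _) = nt
  safe⇒notTarget (read-𝕔 nt _) = nt
  safe⇒notTarget (read-other nt) = nt

  safe⇒miss : ∀ u t {a b c} → Safe a b c (u ++ t) →
    count 𝕒 u + a ≡ suc m → count 𝕓 u + b ≡ 1 → count 𝕔 u + c ≡ 1 → (∀ j → count (other j) u ≡ 0) → ⊥
  safe⇒miss [] t safe e𝕒 e𝕓 e𝕔 _ = safe⇒notTarget safe (cong₂ _,_ e𝕒 (cong₂ _,_ e𝕓 e𝕔))
  safe⇒miss (𝕒 ∷ u) t {a} (read-𝕒 _ safe) e𝕒 e𝕓 e𝕔 e-other =
    safe⇒miss u t safe (trans (+-suc _ a) e𝕒) e𝕓 e𝕔 e-other
  safe⇒miss (𝕓 ∷ u) t {b = b} (read-𝕓 _ safe) e𝕒 e𝕓 e𝕔 e-other =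
    safe⇒miss u t safe e𝕒 (trans (+-suc _ b) e𝕓) e𝕔 e-other
  safe⇒miss (𝕔 ∷ u) t {c = c} (read-𝕔 _ safe) e𝕒 e𝕓 e𝕔 e-other =
    safe⇒miss u t safe e𝕒 e𝕓 (trans (+-suc _ c) e𝕔) e-other
  safe⇒miss (other j ∷ u) t _ _ _ _ e-other with trans (sym (count-≡ {a = other j} u refl)) (e-other j)
  ... | ()

  target : Vec ℕ (3 + n)
  target = suc m ∷ᵥ 1 ∷ᵥ 1 ∷ᵥ replicateᵥ n 0

  order-target : order target ≡ k ∸ 1
  order-target = trans (cong (λ x → suc m + (2 + x)) (sum-replicate-0 n)) (+-comm (suc m) 2)

  word-misses-target : ∀ ps → All (λ p → order p ≡ k) ps → ∀ u → Substring u (word ps) → pv u ≢ target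
  word-misses-target ps ords u (x , t , w≡) pu≡target =
    safe⇒miss u t (safeSuffixes⇒safe x (u ++ t) (subst SafeSuffixes w≡ (safeSuffixes-word ps ords)))
      (trans (+-comm _ 0) (count-pv {u = u} 𝕒 pu≡target))
      (trans (+-comm _ 0) (count-pv {u = u} 𝕓 pu≡target))
      (trans (+-comm _ 0) (count-pv {u = u} 𝕔 pu≡target))
      (λ j → trans (count-pv {u = u} (other j) pu≡target) (lookup-replicate j 0))

  candidates : List (Vec ℕ (3 + n))
  candidates = compositions (3 + n) k

  word-covering : Covering k (word candidates)
  word-covering p ord =
    block p , block-substring (subst (λ j → p ∈ compositions (3 + n) j) ord (∈-compositions p)) , pv-block p

  word-not-covering : ¬ Covering (k ∸ 1) (word candidates)
  word-not-covering covering with covering target order-target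
  ... | u , u⊆w , pu≡target = word-misses-target candidates (compositions-sum (3 + n) k) u u⊆w pu≡target

proposition3 : (σ k : ℕ) → 3 ≤ σ → 4 ≤ k →
    ∃[ w ] (Covering {σ} k w × ¬ Covering {σ} (k ∸ 1) w)
proposition3 _ _ (s≤s (s≤s (s≤s (z≤n {n})))) (s≤s (s≤s (s≤s (s≤s (z≤n {m}))))) =
  word candidates , word-covering , word-not-covering
  where open Construction n m
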